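{- Let $\Gamma$ be a temporal theory and let $M$ be a total $\mathrm{THT}$ model. The following are equivalent: (1) $M$ is a temporal equilibrium model of $\Gamma$. (2) For every temporal formula $\varphi$, $\Gamma\cup\{\neg\psi\mid\psi\notin\mathrm{Th}(M)\}\models_{\mathrm{THT}}\varphi$ if and only if $\varphi\in\mathrm{Th}(M)$.
   Context: Temporal formulas over a countable set $\mathbb{P}$ of atoms are generated by $\varphi ::= p \mid \bot \mid \varphi\wedge\varphi \mid \varphi\vee\varphi \mid \varphi\to\varphi \mid \circ\varphi \mid \varphi\,\mathcal{U}\,\varphi \mid \varphi\,\mathcal{R}\,\varphi$, with $\neg\varphi:=\varphi\to\bot$. A $\mathrm{THT}$ model is $\langle(W,\preccurlyeq,S),V\rangle$ where $W=\mathbb{N}\times\{0,1\}$, $(i,h)\preccurlyeq(j,t)$ iff $i=j$ and $h\le t$, $S((i,k))=(i+1,k)$, and $V:W\to2^{\mathbb{P}}$ satisfies $V((i,0))\subseteq V((i,1))$. Satisfaction is defined as follows: - $p$ holds at $w$ iff $p\in V(w)$. - $\bot$ never holds. - $\wedge$ and $\vee$ are pointwise. - $\varphi\to\psi$ holds at $w$ iff for all $v\succcurlyeq w$, if $\varphi$ holds at $v$ then $\psi$ holds at $v$. - $\circ\varphi$ holds at $w$ iff $\varphi$ holds at $S(w)$. - $\varphi\,\mathcal{U}\,\psi$ holds at $w$ iff for some $k\ge0$, $\psi$ holds at $S^k(w)$ and $\varphi$ holds at $S^i(w)$ for all $0\le i<k$. - $\varphi\,\mathcal{R}\,\psi$ holds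 at $w$ iff for all $k\ge0$, $\psi$ holds at $S^k(w)$ or $\varphi$ holds at $S^i(w)$ for some $0\le i<k$. $M$ is total if $V((i,0))=V((i,1))$ for all $i$. $\mathrm{Th}(M):=\{\varphi\mid M,(0,0)\models\varphi\}$. $\Gamma\models_{\mathrm{THT}}\varphi$ means that for every $\mathrm{THT}$ model $M'$ and every world $w$, if $M',w$ satisfies all formulas of $\Gamma$, then $M',w\models\varphi$. For $\mathrm{THT}$ models $M'=\langle F,V'\rangle$ and $M=\langle F,V\rangle$ on the same frame $F$: - $M'\le M$ if $V'((i,1))=V((i,1))$ and $V'((i,0))\subseteq V((i,0))$ for all $i\ge0$. - $M'<M$ if $M'\le M$ and $V'\neq V$. A total $\mathrm{THT}$ model $M$ is a temporal equilibrium model of a theory $\Gamma$ if $M,(0,0)$ satisfies all of $\Gamma$ and there is no $M'<M$ with $M',(0,0)$ satisfying all of $\Gamma$. -}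

module Defs where

open import Data.Nat as ℕ using (ℕ; zero; suc; _+_)
open import Data.Bool as B using (Bool; true; false)
open import Data.Product using (Σ; _×_; _,_; ∃)
open import Data.Sum using (_⊎_)
open import Data.Empty using (⊥)
open import Relation.Nullary using (¬_)
open import Relation.Binary.PropositionalEquality using (_≡_)

Atom : Set
Atom = ℕ

infixr 6 _∧_
infixr 5 _∨_
infixr 4 _⇒_

data Formula : Set where
  atom : Atom → Formula
  ⊥f   : Formula
  _∧_  : Formula → Formula → Formula
  _∨_  : Formula → Formula → Formula
  _⇒_  : Formula → Formula → Formula
  ○    : Formula → Formula
  _U_  : Formula → Formula → Formula
  _R_  : Formula → Formula → Formula

∼_ : Formula → Formula
∼ φ = φ ⇒ ⊥f

-- Worlds W = ℕ × {0,1}; the second component is Bool with false = 0 (here), true = 1 (there).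
World : Set
World = ℕ × Bool

_≼_ : World → World → Set
(i , h) ≼ (j , t) = (i ≡ j) × (h B.≤ t)

S : World → World
S (i , h) = (suc i , h)

Sⁿ : ℕ → World → World
Sⁿ k (i , h) = (i + k , h)

-- A THT model on the fixed frame: a valuation V : W → 2^ℙ (subsets as Bool-valued
-- characteristic functions) with V((i,0)) ⊆ V((i,1)).
record THT : Set where
  field
    V    : World → Atom → Bool
    mono : ∀ i p → V (i , false) p ≡ true → V (i , true) p ≡ true
open THT public

_,_⊨_ : THT → World → Formula → Set
M , w ⊨ atom p = V M w p ≡ true
M , w ⊨ ⊥f = ⊥
M , w ⊨ (φ ∧ ψ) = (M , w ⊨ φ) × (M , w ⊨ ψ)
M , w ⊨ (φ ∨ ψ) = (M , w ⊨ φ) ⊎ (M , w ⊨ ψ)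
M , w ⊨ (φ ⇒ ψ) = ∀ v → w ≼ v → M , v ⊨ φ → M , v ⊨ ψ
M , w ⊨ ○ φ = M , S w ⊨ φ
M , w ⊨ (φ U ψ) = Σ ℕ λ k → (M , Sⁿ k w ⊨ ψ) × (∀ i → i ℕ.< k → M , Sⁿ i w ⊨ φ)
M , w ⊨ (φ R ψ) = ∀ k → (M , Sⁿ k w ⊨ ψ) ⊎ (Σ ℕ λ i → (i ℕ.< k) × (M , Sⁿ i w ⊨ φ))

Theory : Set₁
Theory = Formula → Set

Sat : THT → World → Theory → Set
Sat M w Γ = ∀ φ → Γ φ → M , w ⊨ φ

w₀ : World
w₀ = (0 , false)

Th : THT → Theory
Th M φ = M , w₀ ⊨ φ

_⊨THT_ : Theory → Formula → Set
Γ ⊨THT φ = ∀ (M' : THT) (w : World) → Sat M' w Γ → M' , w ⊨ φ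

_∪¬compl_ : Theory → THT → Theory
(Γ ∪¬compl M) χ = Γ χ ⊎ (Σ Formula λ ψ → (¬ Th M ψ) × (χ ≡ ∼ ψ))

Total : THT → Set
Total M = ∀ i p → V M (i , false) p ≡ V M (i , true) p

_≤M_ : THT → THT → Set
M' ≤M M = ∀ i p → (V M' (i , true) p ≡ V M (i , true) p)
                 × (V M' (i , false) p ≡ true → V M (i , false) p ≡ true)

_<M_ : THT → THT → Set
M' <M M = (M' ≤M M) × ¬ (∀ w p → V M' w p ≡ V M w p)

TemporalEquilibrium : Theory → THT → Set
TemporalEquilibrium Γ M =
  Total M × Sat M w₀ Γ × ¬ (Σ THT λ M' → (M' <M M) × Sat M' w₀ Γ)

{-# OPTIONS --safe #-}
-- A model of Γ ∪ {¬ψ | ψ ∉ Th(M)} at a world (x, h) agrees with M, shifted by x, on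
-- all there-worlds: the formulas ¬○ᵏp and ¬¬○ᵏp of the extended theory pin down every
-- atom. At a there-world this transfers Th(M) directly. At a here-world the suffix of
-- the model from x is a model of Γ below M, so minimality forces it to coincide with M.
-- Conversely, a model N < M of Γ satisfies the extended theory at (0,0) and therefore
-- every ○ᵏp true in M, which forces N = M.
module Submission where

open import Defs
open import Function.Base using (id; _∘_)
open import Function.Bundles using (_⇔_; mk⇔; Equivalence)
open import Function.Construct.Identity using (⇔-id)
open import Function.Construct.Composition using (_⇔-∘_)
open import Data.Nat using (ℕ; zero; suc; _+_)
open import Data.Nat.Properties using (+-identityʳ; +-suc; +-assoc)
open import Data.Bool as B using (Bool; true; false; _≟_)
open import Data.Bool.Properties using (≤-trans; ≤-maximum; ⇔→≡)
open import Data.Product using (Σ; _×_; _,_; proj₁; proj₂; map₂)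
open import Data.Sum as Sum using (inj₁; inj₂)
open import Relation.Nullary using (¬_)
open import Relation.Nullary.Decidable using (decidable-stable)
open import Relation.Binary.PropositionalEquality

open Equivalence using (to; from)

persistence : (M : THT) (φ : Formula) {x : ℕ} {h : Bool} →
              M , (x , h) ⊨ φ → M , (x , true) ⊨ φ
persistence M (atom p) {h = false} a = mono M _ p a
persistence M (atom p) {h = true}  a = a
persistence M (φ ∧ ψ) (a , b) = persistence M φ a , persistence M ψ b
persistence M (φ ∨ ψ) a∨b = Sum.map (persistence M φ) (persistence M ψ) a∨b
persistence M (φ ⇒ ψ) {h = h} f v (refl , true≤h′) = f v (refl , ≤-trans (≤-maximum h) true≤h′)
persistence M (○ φ) a = persistence M φ a
persistence M (φ U ψ) (k , a , bs) = k , persistence M ψ a , λ i i<k → persistence M φ (bs i i<k)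
persistence M (φ R ψ) f k = Sum.map (persistence M ψ) (map₂ (map₂ (persistence M φ))) (f k)

total-there⇒here : (M : THT) → Total M → (φ : Formula) {x : ℕ} →
                   M , (x , true) ⊨ φ → M , (x , false) ⊨ φ
total-there⇒here M tot (atom p) {x} a = trans (tot x p) a
total-there⇒here M tot (φ ∧ ψ) (a , b) = total-there⇒here M tot φ a , total-there⇒here M tot ψ b
total-there⇒here M tot (φ ∨ ψ) a∨b = Sum.map (total-there⇒here M tot φ) (total-there⇒here M tot ψ) a∨b
total-there⇒here M tot (φ ⇒ ψ) f (_ , false) (refl , _) a =
  total-there⇒here M tot ψ (f _ (refl , B.b≤b) (persistence M φ a))
total-there⇒here M tot (φ ⇒ ψ) f (_ , true) (refl , _) a = f _ (refl , B.b≤b) a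
total-there⇒here M tot (○ φ) a = total-there⇒here M tot φ a
total-there⇒here M tot (φ U ψ) (k , a , bs) =
  k , total-there⇒here M tot ψ a , λ i i<k → total-there⇒here M tot φ (bs i i<k)
total-there⇒here M tot (φ R ψ) f k =
  Sum.map (total-there⇒here M tot ψ) (map₂ (map₂ (total-there⇒here M tot φ))) (f k)

record AgreeFrom (h₀ : Bool) (A : THT) (x : ℕ) (B : THT) (y : ℕ) : Set where
  constructor agreeFrom
  field
    agree : ∀ k {h} → h₀ B.≤ h → ∀ p → V A (x + k , h) p ≡ V B (y + k , h) p

AgreeFrom-there : {A B : THT} {x y : ℕ} →
                  (∀ k p → V A (x + k , true) p ≡ V B (y + k , true) p) → AgreeFrom true A x B y
AgreeFrom-there A≈B = agreeFrom λ { k B.b≤b → A≈B k }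

module _ {h₀ : Bool} {A B : THT} {x y : ℕ} (A≈B : AgreeFrom h₀ A x B y) where
  open AgreeFrom A≈B

  AgreeFrom-sym : AgreeFrom h₀ B y A x
  AgreeFrom-sym = agreeFrom λ k le p → sym (agree k le p)

  AgreeFrom-now : ∀ {h} → h₀ B.≤ h → ∀ p → V A (x , h) p ≡ V B (y , h) p
  AgreeFrom-now {h} le p =
    subst₂ (λ i j → V A (i , h) p ≡ V B (j , h) p) (+-identityʳ x) (+-identityʳ y) (agree 0 le p)

  AgreeFrom-suc : AgreeFrom h₀ A (suc x) B (suc y)
  AgreeFrom-suc = agreeFrom λ k {h} le p →
    subst₂ (λ i j → V A (i , h) p ≡ V B (j , h) p) (+-suc x k) (+-suc y k) (agree (suc k) le p)

  AgreeFrom-+ : ∀ n → AgreeFrom h₀ A (x + n) B (y + n)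
  AgreeFrom-+ n = agreeFrom λ k {h} le p →
    subst₂ (λ i j → V A (i , h) p ≡ V B (j , h) p)
           (sym (+-assoc x n k)) (sym (+-assoc y n k)) (agree (n + k) le p)

AgreeFrom⇒⊨ : (φ : Formula) {h₀ h : Bool} {A B : THT} {x y : ℕ} →
              AgreeFrom h₀ A x B y → h₀ B.≤ h → A , (x , h) ⊨ φ → B , (y , h) ⊨ φ
AgreeFrom⇒⊨ (atom p) A≈B le a = trans (sym (AgreeFrom-now A≈B le p)) a
AgreeFrom⇒⊨ (φ ∧ ψ) A≈B le (a , b) = AgreeFrom⇒⊨ φ A≈B le a , AgreeFrom⇒⊨ ψ A≈B le b
AgreeFrom⇒⊨ (φ ∨ ψ) A≈B le a∨b = Sum.map (AgreeFrom⇒⊨ φ A≈B le) (AgreeFrom⇒⊨ ψ A≈B le) a∨b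
AgreeFrom⇒⊨ (φ ⇒ ψ) {h₀} A≈B le f (_ , h′) (refl , h≤h′) b =
  AgreeFrom⇒⊨ ψ A≈B h₀≤h′ (f _ (refl , h≤h′) (AgreeFrom⇒⊨ φ (AgreeFrom-sym A≈B) h₀≤h′ b))
  where
    h₀≤h′ : h₀ B.≤ h′
    h₀≤h′ = ≤-trans le h≤h′
AgreeFrom⇒⊨ (○ φ) A≈B le a = AgreeFrom⇒⊨ φ (AgreeFrom-suc A≈B) le a
AgreeFrom⇒⊨ (φ U ψ) A≈B le (k , a , bs) =
  k , AgreeFrom⇒⊨ ψ (AgreeFrom-+ A≈B k) le a ,
  λ i i<k → AgreeFrom⇒⊨ φ (AgreeFrom-+ A≈B i) le (bs i i<k)
AgreeFrom⇒⊨ (φ R ψ) A≈B le f k =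
  Sum.map (AgreeFrom⇒⊨ ψ (AgreeFrom-+ A≈B k) le)
          (λ { (i , i<k , b) → i , i<k , AgreeFrom⇒⊨ φ (AgreeFrom-+ A≈B i) le b })
          (f k)

suffix : ℕ → THT → THT
suffix x M = record { V = λ { (k , h) → V M (x + k , h) } ; mono = λ k → mono M (x + k) }

suffix-agrees : (M : THT) (x : ℕ) → AgreeFrom false M x (suffix x M) 0
suffix-agrees M x = agreeFrom λ _ _ _ → refl

○^ : ℕ → Formula → Formula
○^ zero    φ = φ
○^ (suc k) φ = ○ (○^ k φ)

⊨-cong-time : (M : THT) (φ : Formula) {x y : ℕ} {h : Bool} →
              x ≡ y → (M , (x , h) ⊨ φ) ⇔ (M , (y , h) ⊨ φ)
⊨-cong-time M φ refl = ⇔-id _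

⊨○^⇔ : (M : THT) (φ : Formula) (k x : ℕ) {h : Bool} →
       (M , (x , h) ⊨ ○^ k φ) ⇔ (M , (x + k , h) ⊨ φ)
⊨○^⇔ M φ zero    x = ⊨-cong-time M φ (sym (+-identityʳ x))
⊨○^⇔ M φ (suc k) x = ⊨-cong-time M φ (sym (+-suc x k)) ⇔-∘ ⊨○^⇔ M φ k (suc x)

≤M-refl : (M : THT) → M ≤M M
≤M-refl M i p = refl , id

≤M∧≮M⇒≡ : {M′ M : THT} → M′ ≤M M → ¬ (M′ <M M) → ∀ w p → V M′ w p ≡ V M w p
≤M∧≮M⇒≡ {M′} {M} M′≤M M′≮M w p =
  decidable-stable (V M′ w p ≟ V M w p) λ M′≢M → M′≮M (M′≤M , λ M′≡M → M′≢M (M′≡M w p))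

module _ {Γ : Theory} {M : THT} (tot : Total M) where

  Sat-∪¬compl : {N : THT} → N ≤M M → Sat N w₀ Γ → Sat N w₀ (Γ ∪¬compl M)
  Sat-∪¬compl N≤M NΓ φ (inj₁ φ∈Γ) = NΓ φ φ∈Γ
  Sat-∪¬compl {N} N≤M NΓ _ (inj₂ (ψ , ψ∉ThM , refl)) _ (refl , _) Nψ =
    ψ∉ThM (total-there⇒here M tot ψ (AgreeFrom⇒⊨ ψ N≈M-there B.b≤b (persistence N ψ Nψ)))
    where
      N≈M-there : AgreeFrom true N 0 M 0
      N≈M-there = AgreeFrom-there λ k p → proj₁ (N≤M k p)

  ∪¬compl-refutes-there : {M′ : THT} {x : ℕ} {h : Bool} → Sat M′ (x , h) (Γ ∪¬compl M) →
                          ∀ ψ → ¬ Th M ψ → ¬ (M′ , (x , true) ⊨ ψ)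
  ∪¬compl-refutes-there {h = h} sat ψ ψ∉ThM =
    sat (∼ ψ) (inj₂ (ψ , ψ∉ThM , refl)) _ (refl , ≤-maximum h)

  ∪¬compl-fixes-there : {M′ : THT} {x : ℕ} {h : Bool} → Sat M′ (x , h) (Γ ∪¬compl M) →
                        ∀ k p → V M (k , true) p ≡ V M′ (x + k , true) p
  ∪¬compl-fixes-there {M′} {x} sat k p = ⇔→≡ (mk⇔ M→M′ M′→M)
    where
      ThM-○^ : Th M (○^ k (atom p)) ⇔ (V M (k , true) p ≡ true)
      ThM-○^ = mk⇔ (trans (sym (tot k p))) (trans (tot k p)) ⇔-∘ ⊨○^⇔ M (atom p) k 0

      M′-○^ : (M′ , (x , true) ⊨ ○^ k (atom p)) ⇔ (V M′ (x + k , true) p ≡ true)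
      M′-○^ = ⊨○^⇔ M′ (atom p) k x

      M→M′ : V M (k , true) p ≡ true → V M′ (x + k , true) p ≡ true
      M→M′ Mp = decidable-stable (_ ≟ true) λ M′¬p →
        ∪¬compl-refutes-there sat (∼ ○^ k (atom p))
          (λ ThM∼○^ → ThM∼○^ w₀ (refl , B.b≤b) (from ThM-○^ Mp))
          (λ { _ (refl , _) M′○^ → M′¬p (to M′-○^ (persistence M′ (○^ k (atom p)) M′○^)) })

      M′→M : V M′ (x + k , true) p ≡ true → V M (k , true) p ≡ true
      M′→M M′p = decidable-stable (_ ≟ true) λ M¬p →
        ∪¬compl-refutes-there sat (○^ k (atom p)) (M¬p ∘ to ThM-○^) (from M′-○^ M′p)

equilibrium-entails-Th : {Γ : Theory} {M : THT} → TemporalEquilibrium Γ M →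
                         ∀ φ → Th M φ → (Γ ∪¬compl M) ⊨THT φ
equilibrium-entails-Th (tot , _ , _) φ Mφ M′ (x , true) sat =
  AgreeFrom⇒⊨ φ (AgreeFrom-there (∪¬compl-fixes-there tot sat)) B.b≤b (persistence _ φ Mφ)
equilibrium-entails-Th {Γ} {M} (tot , _ , minimal) φ Mφ M′ (x , false) sat =
  AgreeFrom⇒⊨ φ (AgreeFrom-sym (suffix-agrees M′ x)) B.b≤b (AgreeFrom⇒⊨ φ M≈N B.b≤b Mφ)
  where
    N : THT
    N = suffix x M′

    M≈M′-there : ∀ k p → V M (k , true) p ≡ V M′ (x + k , true) p
    M≈M′-there = ∪¬compl-fixes-there tot sat

    N≤M : N ≤M M
    N≤M k p = sym (M≈M′-there k p) ,
              λ Np → trans (tot k p) (trans (M≈M′-there k p) (mono M′ (x + k) p Np))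

    NΓ : Sat N w₀ Γ
    NΓ ψ ψ∈Γ = AgreeFrom⇒⊨ ψ (suffix-agrees M′ x) B.b≤b (sat ψ (inj₁ ψ∈Γ))

    M≈N : AgreeFrom false M 0 N 0
    M≈N = agreeFrom λ k {h} _ p →
      sym (≤M∧≮M⇒≡ {N} {M} N≤M (λ N<M → minimal (N , N<M , NΓ)) (k , h) p)

characterisation⇒equilibrium : {Γ : Theory} {M : THT} → Total M →
                               (∀ φ → ((Γ ∪¬compl M) ⊨THT φ) ⇔ Th M φ) → TemporalEquilibrium Γ M
characterisation⇒equilibrium {Γ} {M} tot char = tot , MΓ , minimal
  where
    MΓ : Sat M w₀ Γ
    MΓ φ φ∈Γ = to (char φ) (λ _ _ sat → sat φ (inj₁ φ∈Γ))

    minimal : ¬ (Σ THT λ N → (N <M M) × Sat N w₀ Γ)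
    minimal (N , (N≤M , N≢M) , NΓ) = N≢M λ
      { (k , true)  p → proj₁ (N≤M k p)
      ; (k , false) p → ⇔→≡ (mk⇔ (proj₂ (N≤M k p)) (M→N k p)) }
      where
        M→N : ∀ k p → V M (k , false) p ≡ true → V N (k , false) p ≡ true
        M→N k p Mp =
          to (⊨○^⇔ N (atom p) k 0)
             (from (char (○^ k (atom p))) (from (⊨○^⇔ M (atom p) k 0) Mp)
                   N w₀ (Sat-∪¬compl tot N≤M NΓ))

lemma12 : (Γ : Theory) (M : THT) → Total M →
          TemporalEquilibrium Γ M ⇔ (∀ φ → ((Γ ∪¬compl M) ⊨THT φ) ⇔ Th M φ)
lemma12 Γ M tot = mk⇔ equilibrium⇒characterisation (characterisation⇒equilibrium tot)
  where
    equilibrium⇒characterisation : TemporalEquilibrium Γ M → ∀ φ → ((Γ ∪¬compl M) ⊨THT φ) ⇔ Th M φ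
    equilibrium⇒characterisation equilibrium@(_ , MΓ , _) φ =
      mk⇔ (λ entails → entails M w₀ (Sat-∪¬compl tot (≤M-refl M) MΓ))
          (equilibrium-entails-Th equilibrium φ)
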